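{- Let $H=(\mathcal{V},\mathcal{E})$ be a hypergraph. Let $\chi_{cf}(H)$ be the number of non-zero colours used in an optimal conflict-free colouring of $H$, and let $\chi_{min}=\min_{R,t}\chi(G_{R,t})$ be the minimum chromatic number over all co-occurrence graphs $G_{R,t}$ of $H$. Then $\chi_{cf}(H)=\chi_{min}$.
   Context: A hypergraph $H=(\mathcal{V},\mathcal{E})$ has a finite vertex set $\mathcal{V}$ and a set $\mathcal{E}$ of non-empty subsets of $\mathcal{V}$ (hyperedges). A conflict-free colouring of $H$ is a function $C:\mathcal{V}\to\mathbb{N}=\{0,1,2,\dots\}$ such that for every hyperedge $E\in\mathcal{E}$ there is a colour $j\in\mathbb{Z}^+$ with $|E\cap C^{ -1}(j)|=1$ (colour $0$ is a special "uncoloured" colour and does not count). $\chi_{cf}(H)$ is the minimum number of non-zero colours used by a conflict-free colouring of $H$. A representative function is a map $t:\mathcal{E}\to\mathcal{V}$ with $t(E)\in E$ for all $E\in\mathcal{E}$; let $R=t(\mathcal{E})$ be its image. The co-occurrence graph $G_{R,t}$ is the simple graph with vertex set $R$ in which distinct $u,v\in R$ are adjacent iff there is a hyperedge $E\in\mathcal{E}$ with $u,v\in E$ and $t(E)\in\{u,v\}$. $\chi(G)$ denotes the chromatic number of a graph $G$. -}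

module Defs where

open import Data.Nat using (ℕ; zero; suc; _≤_)
open import Data.Fin using (Fin)
open import Data.Fin.Subset using (Subset; _∈_; Nonempty)
open import Data.Product using (Σ; ∃; _×_; _,_; proj₁; proj₂; Σ-syntax; ∃-syntax)
open import Data.Sum using (_⊎_)
open import Relation.Binary.PropositionalEquality using (_≡_; _≢_)
open import Function.Definitions using (Injective)

-- A hypergraph with vertex set Fin n and m hyperedges, given as an
-- injective family (so the hyperedges form a *set*) of non-empty subsets.
record Hypergraph : Set where
  field
    n        : ℕ
    m        : ℕ
    edge     : Fin m → Subset n
    edge-inj : Injective _≡_ _≡_ edge
    nonempty : (e : Fin m) → Nonempty (edge e)
open Hypergraph public

-- A colouring; colour 0 means "uncoloured".
Colouring : Hypergraph → Set
Colouring H = Fin (n H) → ℕ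

ConflictFree : (H : Hypergraph) → Colouring H → Set
ConflictFree H C = (e : Fin (m H)) → Σ[ j ∈ ℕ ] (j ≢ 0 ×
  Σ[ v ∈ Fin (n H) ] ((v ∈ edge H e × C v ≡ j) ×
    ((w : Fin (n H)) → w ∈ edge H e → C w ≡ j → w ≡ v)))

-- C uses exactly k non-zero colours: Fin k is in bijection (via f) with
-- the set { j ≠ 0 | j = C v for some v }.
UsesNonzeroColours : (H : Hypergraph) → Colouring H → ℕ → Set
UsesNonzeroColours H C k = Σ[ f ∈ (Fin k → ℕ) ] (Injective _≡_ _≡_ f ×
  ((i : Fin k) → f i ≢ 0 × ∃[ v ] C v ≡ f i) ×
  ((v : Fin (n H)) → C v ≢ 0 → ∃[ i ] f i ≡ C v))

IsMinimum : (ℕ → Set) → ℕ → Set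
IsMinimum P k = P k × ((j : ℕ) → P j → k ≤ j)

IsChiCF : Hypergraph → ℕ → Set
IsChiCF H = IsMinimum (λ k → Σ[ C ∈ Colouring H ] (ConflictFree H C × UsesNonzeroColours H C k))

Representative : Hypergraph → Set
Representative H = Σ[ t ∈ (Fin (m H) → Fin (n H)) ] ((e : Fin (m H)) → t e ∈ edge H e)

InR : (H : Hypergraph) → Representative H → Fin (n H) → Set
InR H r v = ∃[ e ] proj₁ r e ≡ v

Adj : (H : Hypergraph) → Representative H → Fin (n H) → Fin (n H) → Set
Adj H r u v = InR H r u × InR H r v × u ≢ v ×
  ∃[ e ] (u ∈ edge H e × v ∈ edge H e × (proj₁ r e ≡ u ⊎ proj₁ r e ≡ v))

ProperColouring : (H : Hypergraph) → Representative H → ℕ → Set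
ProperColouring H r k = Σ[ c ∈ ((v : Fin (n H)) → InR H r v → Fin k) ]
  ((u v : Fin (n H)) (a : Adj H r u v) → c u (proj₁ a) ≢ c v (proj₁ (proj₂ a)))

IsChromatic : (H : Hypergraph) → Representative H → ℕ → Set
IsChromatic H r = IsMinimum (ProperColouring H r)

IsChiMin : Hypergraph → ℕ → Set
IsChiMin H = IsMinimum (λ k → Σ[ r ∈ Representative H ] IsChromatic H r k)

module Submission where

-- Both sides are compared with one auxiliary invariant: the least k for
-- which H has a conflict-free colouring with PALETTE k, i.e. a map
-- C : V → Fin (suc k) (0 = uncoloured) such that every hyperedge contains a
-- DISTINGUISHED vertex, non-zero and of a colour that no other vertex of the
-- hyperedge carries.  Such k exist (k = |V|, all colours distinct) and the
-- property is decidable (finitely many colourings), so a least one, k, exists.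
--
--  * A conflict-free colouring using j colours re-indexes to palette j, and a
--    palette colouring of minimal size k uses all k colours (an unused one
--    could be squeezed out), so it is a conflict-free colouring using k
--    colours: χ_cf(H) = k.
--  * Choosing a distinguished vertex t(E) in every hyperedge E, the palette
--    colouring restricted to R = t(E) is a proper k-colouring of G_{R,t};
--    conversely a proper j-colouring of any G_{R,t}, extended by 0 outside R,
--    is a palette-j colouring with t(E) distinguished.  Hence the G_{R,t}
--    above has chromatic number k and no G_{R,t} has a smaller one:
--    χ_min(H) = k.

open import Defs
open import Data.Nat using (ℕ; zero; suc; _<_; _≤_; _≟_)
open import Data.Nat.Properties using (≮⇒≥; anyUpTo?; <-irrefl)
open import Data.Nat.Induction using (<-wellFounded)
open import Induction.WellFounded using (Acc; acc)
open import Data.Product using (Σ-syntax; ∃; ∃-syntax; _×_; _,_; proj₁; proj₂)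
open import Data.Sum using (inj₁; inj₂)
open import Data.Fin using (Fin; zero; suc; toℕ; punchOut)
open import Data.Fin.Properties as Fin
  using (any?; all?; toℕ-injective; suc-injective; punchOut-injective; 0≢1+n)
open import Data.Fin.Subset using (_∈_)
open import Data.Fin.Subset.Properties using (_∈?_)
open import Data.Vec.Functional using (_∷_; head; tail)
open import Function using (_∘_)
open import Relation.Unary using (Decidable)
open import Relation.Nullary using (Dec; yes; no; ¬?; contradiction)
open import Relation.Nullary.Decidable using (map′; _×-dec_; _→-dec_)
open import Relation.Binary.PropositionalEquality
  using (_≡_; _≢_; _≗_; refl; sym; trans; cong; ≢-sym)

minimum-exists : (P : ℕ → Set) → Decidable P → ∀ {n} → P n → ∃ (IsMinimum P)
minimum-exists P P? {n} = descend n (<-wellFounded n)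
  where
  descend : ∀ n → Acc _<_ n → P n → ∃ (IsMinimum P)
  descend n (acc smaller) pn with anyUpTo? P? n
  ... | yes (j , j<n , pj) = descend j (smaller j<n) pj
  ... | no none            = n , pn , λ j pj → ≮⇒≥ (λ j<n → none (j , j<n , pj))

anyFunction? : ∀ m {k} (P : (Fin m → Fin k) → Set) →
               (∀ {f g} → f ≗ g → P f → P g) → Decidable P → Dec (∃ P)
anyFunction? zero {k} P resp P? =
  map′ (λ p → empty , p) (λ (f , p) → resp (λ ()) p) (P? empty)
  where
  empty : Fin zero → Fin k
  empty ()
anyFunction? (suc m) P resp P? =
  map′ (λ (a , g , p) → a ∷ g , p) (λ (f , p) → head f , tail f , resp head∷tail p)
       (any? λ a → anyFunction? m (P ∘ (a ∷_)) (resp ∘ cons-cong) (P? ∘ (a ∷_)))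
  where
  cons-cong : ∀ {a} {g h : Fin m → _} → g ≗ h → (a ∷ g) ≗ (a ∷ h)
  cons-cong g≗h zero    = refl
  cons-cong g≗h (suc i) = g≗h i
  head∷tail : ∀ {f : Fin (suc m) → _} → f ≗ (head f ∷ tail f)
  head∷tail zero    = refl
  head∷tail (suc i) = refl

punchOut-zero : ∀ {k} {c : Fin (suc k)} {j : Fin (suc (suc k))} (c≢j : suc c ≢ j) →
                punchOut c≢j ≡ zero → j ≡ zero
punchOut-zero {j = zero}  _ _  = refl
punchOut-zero {j = suc j} _ ()

module _ (H : Hypergraph) where

  Vertex : Set
  Vertex = Fin (n H)

  -- A colouring with palette k: colours 1..k, and 0 for "uncoloured".
  PaletteColouring : ℕ → Set
  PaletteColouring k = Vertex → Fin (suc k)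

  Distinguished : ∀ {k} → PaletteColouring k → Fin (m H) → Vertex → Set
  Distinguished C e v = v ∈ edge H e × C v ≢ zero ×
    ((w : Vertex) → w ∈ edge H e → w ≢ v → C w ≢ C v)

  PaletteCF : ∀ {k} → PaletteColouring k → Set
  PaletteCF C = ∀ e → ∃ (Distinguished C e)

  HasPaletteCF : ℕ → Set
  HasPaletteCF k = Σ[ C ∈ PaletteColouring k ] PaletteCF C

  distinguished? : ∀ {k} (C : PaletteColouring k) e → Decidable (Distinguished C e)
  distinguished? C e v = (v ∈? edge H e) ×-dec ¬? (C v Fin.≟ zero) ×-dec
    all? (λ w → (w ∈? edge H e) →-dec ¬? (w Fin.≟ v) →-dec ¬? (C w Fin.≟ C v))

  paletteCF-cong : ∀ {k} {C C' : PaletteColouring k} → C ≗ C' → PaletteCF C → PaletteCF C'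
  paletteCF-cong C≗C' cf e =
    let (v , v∈e , Cv≢0 , unique) = cf e in
    v , v∈e , (λ C'v≡0 → Cv≢0 (trans (C≗C' v) C'v≡0)) ,
    λ w w∈e w≢v C'w≡C'v → unique w w∈e w≢v (trans (C≗C' w) (trans C'w≡C'v (sym (C≗C' v))))

  hasPaletteCF? : Decidable HasPaletteCF
  hasPaletteCF? k = anyFunction? (n H) PaletteCF paletteCF-cong
    (λ C → all? λ e → any? (distinguished? C e))

  rainbow : HasPaletteCF (n H)
  rainbow = suc , λ e → let (v , v∈e) = nonempty H e in
    v , v∈e , (λ ()) , λ w _ w≢v → w≢v ∘ suc-injective

  -- A conflict-free colouring using j non-zero colours, enumerated by f,
  -- re-indexes to palette j: colour f i becomes i + 1.
  fromConflictFree : ∀ {j} (C : Colouring H) → ConflictFree H C →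
                     UsesNonzeroColours H C j → HasPaletteCF j
  fromConflictFree {j} C cf (f , _ , _ , index) = code , λ e →
    let (c , c≢0 , v , (v∈e , Cv≡c) , unique) = cf e
        Cv≢0 = λ Cv≡0 → c≢0 (trans (sym Cv≡c) Cv≡0)
    in v , v∈e , code-nonzero v Cv≢0 ,
       λ w w∈e w≢v codes≡ → w≢v (unique w w∈e (trans (code-reflects w v codes≡ Cv≢0) Cv≡c))
    where
    encode : ∀ v → Dec (C v ≡ 0) → Fin (suc j)
    encode v (yes _)   = zero
    encode v (no Cv≢0) = suc (proj₁ (index v Cv≢0))
    code : PaletteColouring j
    code v = encode v (C v ≟ 0)
    code-nonzero : ∀ v → C v ≢ 0 → code v ≢ zero
    code-nonzero v Cv≢0 with C v ≟ 0
    ... | yes Cv≡0 = contradiction Cv≡0 Cv≢0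
    ... | no _     = λ ()
    code-reflects : ∀ w v → code w ≡ code v → C v ≢ 0 → C w ≡ C v
    code-reflects w v codes≡ Cv≢0 with C w ≟ 0 | C v ≟ 0
    ... | _        | yes Cv≡0 = contradiction Cv≡0 Cv≢0
    ... | yes _    | no _     = contradiction codes≡ 0≢1+n
    ... | no Cw≢0  | no Cv≢0′ =
      trans (sym (proj₂ (index w Cw≢0)))
            (trans (cong f (suc-injective codes≡)) (proj₂ (index v Cv≢0′)))

  toℕ-conflictFree : ∀ {k} (C : PaletteColouring k) → PaletteCF C → ConflictFree H (toℕ ∘ C)
  toℕ-conflictFree C cf e with cf e
  ... | v , v∈e , Cv≢0 , distinct =
    toℕ (C v) , Cv≢0 ∘ toℕ-injective , v , (v∈e , refl) ,
    λ w w∈e → unique w w∈e ∘ toℕ-injective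
    where
    unique : (w : Vertex) → w ∈ edge H e → C w ≡ C v → w ≡ v
    unique w w∈e Cw≡Cv with w Fin.≟ v
    ... | yes w≡v = w≡v
    ... | no w≢v  = contradiction Cw≡Cv (distinct w w∈e w≢v)

  toℕ-uses : ∀ {k} (C : PaletteColouring k) → (∀ i → ∃[ v ] C v ≡ suc i) →
             UsesNonzeroColours H (toℕ ∘ C) k
  toℕ-uses C occurs = toℕ ∘ suc , suc-injective ∘ toℕ-injective ,
    (λ i → (λ ()) , proj₁ (occurs i) , cong toℕ (proj₂ (occurs i))) , index
    where
    index : ∀ v → toℕ (C v) ≢ 0 → ∃[ i ] toℕ (suc i) ≡ toℕ (C v)
    index v Cv≢0 with C v
    ... | zero  = contradiction refl Cv≢0
    ... | suc i = i , refl

  dropColour : ∀ {k} (C : PaletteColouring (suc k)) → PaletteCF C → (c : Fin (suc k)) →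
               (∀ v → C v ≢ suc c) → HasPaletteCF k
  dropColour C cf c absent = C' , λ e →
    let (v , v∈e , Cv≢0 , distinct) = cf e in
    v , v∈e , Cv≢0 ∘ punchOut-zero (absent′ v) ,
    λ w w∈e w≢v → distinct w w∈e w≢v ∘ punchOut-injective (absent′ w) (absent′ v)
    where
    absent′ : ∀ v → suc c ≢ C v
    absent′ v = ≢-sym (absent v)
    C' : PaletteColouring _
    C' v = punchOut (absent′ v)

  minimal⇒allColoursOccur : ∀ {k} → (∀ j → HasPaletteCF j → k ≤ j) →
    (C : PaletteColouring k) → PaletteCF C → ∀ i → ∃[ v ] C v ≡ suc i
  minimal⇒allColoursOccur {suc k} minimal C cf c with any? (λ v → C v Fin.≟ suc c)
  ... | yes occurs = occurs
  ... | no absent  = contradiction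
    (minimal k (dropColour C cf c (λ v Cv≡c → absent (v , Cv≡c)))) (<-irrefl refl)

  representative : ∀ {k} {C : PaletteColouring k} → PaletteCF C → Representative H
  representative cf = (λ e → proj₁ (cf e)) , (λ e → proj₁ (proj₂ (cf e)))

  -- Restricted to R = t(E), the palette colouring is a proper colouring of
  -- G_{R,t} (with colour i + 1 read as i): a representative differs in
  -- colour from every other vertex of its hyperedge.
  properColouring : ∀ {k} (C : PaletteColouring k) (cf : PaletteCF C) →
                    ProperColouring H (representative cf) k
  properColouring C cf = colour , proper
    where
    coloured : ∀ v → InR H (representative cf) v → zero ≢ C v
    coloured v (e , refl) = ≢-sym (proj₁ (proj₂ (proj₂ (cf e))))
    colour : ∀ v → InR H (representative cf) v → Fin _
    colour v v∈R = punchOut (coloured v v∈R)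
    proper : ∀ u v (a : Adj H (representative cf) u v) →
             colour u (proj₁ a) ≢ colour v (proj₁ (proj₂ a))
    proper u v (u∈R , v∈R , u≢v , e , u∈e , v∈e , inj₁ refl) =
      ≢-sym (proj₂ (proj₂ (proj₂ (cf e))) v v∈e (≢-sym u≢v))
        ∘ punchOut-injective (coloured u u∈R) (coloured v v∈R)
    proper u v (u∈R , v∈R , u≢v , e , u∈e , v∈e , inj₂ refl) =
      proj₂ (proj₂ (proj₂ (cf e))) u u∈e u≢v
        ∘ punchOut-injective (coloured u u∈R) (coloured v v∈R)

  -- Conversely, a proper j-colouring of G_{R,t}, shifted by one on R and 0
  -- elsewhere, is a conflict-free colouring with palette j in which every
  -- t(E) is distinguished.
  fromProperColouring : ∀ (r : Representative H) {j} → ProperColouring H r j → HasPaletteCF j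
  fromProperColouring r@(t , t∈) {j} (colour , proper) = C , λ e →
    t e , t∈ e , representative-coloured e , distinct e
    where
    extend : ∀ v → Dec (InR H r v) → Fin (suc j)
    extend v (yes v∈R) = suc (colour v v∈R)
    extend v (no _)    = zero
    C : PaletteColouring j
    C v = extend v (any? λ e → t e Fin.≟ v)
    representative-coloured : ∀ e → C (t e) ≢ zero
    representative-coloured e with any? (λ e′ → t e′ Fin.≟ t e)
    ... | yes _   = λ ()
    ... | no t∉R  = λ _ → t∉R (e , refl)
    distinct : ∀ e w → w ∈ edge H e → w ≢ t e → C w ≢ C (t e)
    distinct e w w∈e w≢t with any? (λ e′ → t e′ Fin.≟ w) | any? (λ e′ → t e′ Fin.≟ t e)
    ... | _        | no t∉R   = λ _ → t∉R (e , refl)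
    ... | no _     | yes _    = λ ()
    ... | yes w∈R  | yes te∈R =
      proper w (t e) (w∈R , te∈R , w≢t , e , w∈e , t∈ e , inj₂ refl) ∘ suc-injective

theorem1 : (H : Hypergraph) → Σ[ k ∈ ℕ ] (IsChiCF H k × IsChiMin H k)
theorem1 H =
  let (k , (C , cf) , minimal) = minimum-exists (HasPaletteCF H) (hasPaletteCF? H) (rainbow H)
      t = representative H cf
      noSmallerG : ∀ r j → ProperColouring H r j → k ≤ j
      noSmallerG r j = minimal j ∘ fromProperColouring H r
  in k ,
     ( (toℕ ∘ C , toℕ-conflictFree H C cf ,
        toℕ-uses H C (minimal⇒allColoursOccur H minimal C cf))
     , λ j (C′ , cf′ , uses) → minimal j (fromConflictFree H C′ cf′ uses) ) ,
     ( (t , properColouring H C cf , noSmallerG t)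
     , λ j (r , χr) → noSmallerG r j (proj₁ χr) )
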